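{- For every $n\ge1$, the number of integer sequences $e=(e_1,\dots,e_n)$ with $0\le e_i<i$ for all $i$ having no indices $i<j<k$ with $e_i>e_j\ge e_k$ equals the number of such sequences having no indices $i<j<k$ with $e_i\ge e_j>e_k$. -}

module Defs where

open import Data.Nat using (ℕ; zero; suc; _<_; _≤_)
open import Data.List using (List; []; _∷_; length)
open import Data.List.Membership.Propositional using (_∈_)
open import Data.List.Relation.Unary.Unique.Propositional using (Unique)
open import Data.Product using (Σ; ∃; _×_)
open import Relation.Binary.PropositionalEquality using (_≡_)
open import Relation.Nullary using (¬_)
open import Function.Bundles using (_⇔_)

-- Sequences e = (e₁,…,eₙ) are represented as lists of naturals.
-- At e i v  means  "e_i = v"  with 1-based index i.
data At : List ℕ → ℕ → ℕ → Set where
  here  : ∀ {v es} → At (v ∷ es) 1 v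
  there : ∀ {w es i v} → At es i v → At (w ∷ es) (suc i) v

IsInvSeq : ℕ → List ℕ → Set
IsInvSeq n e = (length e ≡ n) × (∀ i v → At e i v → v < i)

Contains-gt-ge : List ℕ → Set
Contains-gt-ge e =
  Σ ℕ λ i → Σ ℕ λ j → Σ ℕ λ k → Σ ℕ λ a → Σ ℕ λ b → Σ ℕ λ c →
    (i < j) × (j < k) × At e i a × At e j b × At e k c × (b < a) × (c ≤ b)

Contains-ge-gt : List ℕ → Set
Contains-ge-gt e =
  Σ ℕ λ i → Σ ℕ λ j → Σ ℕ λ k → Σ ℕ λ a → Σ ℕ λ b → Σ ℕ λ c →
    (i < j) × (j < k) × At e i a × At e j b × At e k c × (b ≤ a) × (c < b)

HasCard : (List ℕ → Set) → ℕ → Set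
HasCard P m = Σ (List (List ℕ)) λ L →
  Unique L × (∀ x → (x ∈ L) ⇔ P x) × (length L ≡ m)

-- Read an inversion sequence from left to right. For either pattern there is a threshold T,
-- depending on the prefix read so far, such that the next entry completes an occurrence exactly
-- when it is below T. Together with the maximum M of the prefix, T evolves by a simple rule:
-- for e_i > e_j ≥ e_k an entry v < M becomes a new middle value and moves T to v + 1, for
-- e_i ≥ e_j > e_k an entry v ≤ M moves T to v, and otherwise T stays. So in both cases the
-- avoiding sequences are the runs of an automaton on states (T , M) whose allowed letters at
-- position n + 1 are T, …, n. The cyclic shift T ↦ T + 1 ↦ … ↦ M ↦ T of [T , M], fixing the
-- values above M, sends each letter of the first automaton to a letter of the second leading
-- to the same state; applied letter by letter it is a bijection between the two sets.

module Submission where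

open import Defs
open import Data.Nat using (ℕ; suc; pred; _<_; _≤_; _≥_; _⊔_; z≤n; s≤s; >-nonZero)
open import Data.Nat.Properties
open import Data.List using (List; []; _∷_; [_]; _++_; _∷ʳ_; length; map)
open import Data.List.Properties using (∷ʳ-++; ++-identityʳ; length-map; map-∘; map-id-local)
open import Data.List.Membership.Propositional using (_∈_)
open import Data.List.Membership.Propositional.Properties using (∈-map⁺; ∈-map⁻)
open import Data.List.Membership.Propositional.Properties.WithK using (unique∧set⇒bag)
open import Data.List.Relation.Unary.All using (tabulate)
open import Data.List.Relation.Unary.Unique.Propositional using (Unique)
open import Data.List.Relation.Unary.Unique.Propositional.Properties using (map⁻)
open import Data.List.Relation.Binary.BagAndSetEquality using (∼bag⇒↭)
open import Data.List.Relation.Binary.Permutation.Propositional.Properties using (↭-length)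
open import Data.Product using (Σ; ∃; _×_; _,_; proj₁; proj₂)
open import Data.Sum using (_⊎_; inj₁; inj₂)
open import Data.Sum.Function.Propositional using (_⊎-⇔_)
open import Data.Unit using (⊤; tt)
open import Function.Base using (_∘_)
open import Function.Bundles using (_⇔_; mk⇔; Equivalence)
import Function.Properties.Equivalence as ⇔
open import Relation.Binary.Definitions using (tri<; tri≈; tri>)
open import Relation.Binary.PropositionalEquality using (_≡_; refl; sym; trans; cong; cong₂; subst)
open import Relation.Nullary using (¬_; yes; no; contradiction)

open Equivalence

private
  variable
    e p q r : List ℕ
    i n v w x M T : ℕ

-- map f L and K are duplicate-free lists with the same members, hence permutations of each other.
HasCard-bijection : ∀ {P Q : List ℕ → Set} {m m′} (f g : List ℕ → List ℕ)
  → (∀ {e} → P e → Q (f e)) → (∀ {e} → Q e → P (g e))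
  → (∀ {e} → P e → g (f e) ≡ e) → (∀ {e} → Q e → f (g e) ≡ e)
  → HasCard P m → HasCard Q m′ → m ≡ m′
HasCard-bijection {Q = Q} f g f-maps g-maps g∘f f∘g
                  (L , L-unique , L⇔P , refl) (K , K-unique , K⇔Q , refl) =
  trans (sym (length-map f L))
        (↭-length (∼bag⇒↭ (unique∧set⇒bag fL-unique K-unique (mk⇔ fL⊆K K⊆fL))))
  where
  fL-unique : Unique (map f L)
  fL-unique = map⁻ (subst Unique (sym gfL≡L) L-unique)
    where
    gfL≡L : map g (map f L) ≡ L
    gfL≡L = trans (sym (map-∘ L)) (map-id-local (tabulate λ d∈L → g∘f (L⇔P _ .to d∈L)))
  fL⊆K : ∀ {d} → d ∈ map f L → d ∈ K
  fL⊆K d∈fL with ∈-map⁻ f d∈fL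
  ... | c , c∈L , refl = K⇔Q _ .from (f-maps (L⇔P c .to c∈L))
  K⊆fL : ∀ {d} → d ∈ K → d ∈ map f L
  K⊆fL {d} d∈K = subst (_∈ map f L) (f∘g Qd) (∈-map⁺ f (L⇔P _ .from (g-maps Qd)))
    where
    Qd : Q d
    Qd = K⇔Q d .to d∈K

At-length : At p i w → i ≤ length p
At-length here      = s≤s z≤n
At-length (there h) = s≤s (At-length h)

At-++ : ∀ q → At p i w → At (p ++ q) i w
At-++ q here      = here
At-++ q (there h) = there (At-++ q h)

At-middle : ∀ p → At (p ++ v ∷ q) (suc (length p)) v
At-middle []      = here
At-middle (_ ∷ p) = there (At-middle p)

At-∷ʳ⁻ : ∀ p → At (p ∷ʳ v) i w → At p i w ⊎ (i ≡ suc (length p) × w ≡ v)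
At-∷ʳ⁻ []      here        = inj₂ (refl , refl)
At-∷ʳ⁻ (_ ∷ p) here        = inj₁ here
At-∷ʳ⁻ (_ ∷ p) (there h) with At-∷ʳ⁻ p h
... | inj₁ h′             = inj₁ (there h′)
... | inj₂ (refl , refl)  = inj₂ (refl , refl)

At-∷ʳ-init : ∀ p → At (p ∷ʳ v) i w → i ≤ length p → At p i w
At-∷ʳ-init p h i≤ with At-∷ʳ⁻ p h
... | inj₁ h′         = h′
... | inj₂ (refl , _) = contradiction i≤ (1+n≰n)

length-∷ʳ : ∀ (p : List ℕ) v → length (p ∷ʳ v) ≡ suc (length p)
length-∷ʳ []      v = refl
length-∷ʳ (_ ∷ p) v = cong suc (length-∷ʳ p v)

Bounded : List ℕ → Set
Bounded e = ∀ i v → At e i v → v < i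

IsMax : List ℕ → ℕ → Set
IsMax p M = (∀ i w → At p i w → w ≤ M) × ∃ λ i → At p i M

IsMax-∷ʳ : ∀ p → IsMax p M → IsMax (p ∷ʳ v) (M ⊔ v)
IsMax-∷ʳ {M} {v} p (≤M , i , M∈p) = ≤M⊔v , attained
  where
  ≤M⊔v : ∀ i w → At (p ∷ʳ v) i w → w ≤ M ⊔ v
  ≤M⊔v i w h with At-∷ʳ⁻ p h
  ... | inj₁ h′        = ≤-trans (≤M i w h′) (m≤m⊔n M v)
  ... | inj₂ (_ , refl) = m≤n⊔m M v
  attained : ∃ λ i → At (p ∷ʳ v) i (M ⊔ v)
  attained with ≤-total v M
  ... | inj₁ v≤M rewrite m≥n⇒m⊔n≡m v≤M = i , At-++ _ M∈p
  ... | inj₂ M≤v rewrite m≤n⇒m⊔n≡n M≤v = suc (length p) , At-middle p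

-- R compares e_j with e_i and S compares e_k with e_j, so Contains _<_ _≤_ is Contains-gt-ge
-- and Contains _≤_ _<_ is Contains-ge-gt.
Contains : (R S : ℕ → ℕ → Set) → List ℕ → Set
Contains R S e = Σ ℕ λ i → Σ ℕ λ j → Σ ℕ λ k → Σ ℕ λ a → Σ ℕ λ b → Σ ℕ λ c →
  (i < j) × (j < k) × At e i a × At e j b × At e k c × R b a × S c b

Contains-[] : ∀ {R S} → ¬ Contains R S []
Contains-[] (_ , _ , _ , _ , _ , _ , _ , _ , () , _)

module Occurrences (R S : ℕ → ℕ → Set) (R-≤-trans : ∀ {v a M} → R v a → a ≤ M → R v M) where

  Middle : List ℕ → ℕ → Set
  Middle p x = Σ ℕ λ i → Σ ℕ λ j → Σ ℕ λ a → (i < j) × At p i a × At p j x × R x a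

  Completes : List ℕ → ℕ → Set
  Completes p w = ∃ λ x → Middle p x × S w x

  Middle-++ : ∀ q → Middle p x → Middle (p ++ q) x
  Middle-++ q (i , j , a , i<j , a∈p , x∈p , Rxa) = i , j , a , i<j , At-++ q a∈p , At-++ q x∈p , Rxa

  Completes-++ : ∀ q → Completes p w → Completes (p ++ q) w
  Completes-++ q (x , mid , Swx) = x , Middle-++ q mid , Swx

  Contains-++ : ∀ q → Contains R S p → Contains R S (p ++ q)
  Contains-++ q (i , j , k , a , b , c , i<j , j<k , a∈p , b∈p , c∈p , Rba , Scb) =
    i , j , k , a , b , c , i<j , j<k , At-++ q a∈p , At-++ q b∈p , At-++ q c∈p , Rba , Scb

  Contains-∷ʳ : ∀ p → Contains R S (p ∷ʳ v) ⇔ (Contains R S p ⊎ Completes p v)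
  Contains-∷ʳ {v} p = mk⇔ split join
    where
    split : Contains R S (p ∷ʳ v) → Contains R S p ⊎ Completes p v
    split (i , j , k , a , b , c , i<j , j<k , a∈ , b∈ , c∈ , Rba , Scb) with At-∷ʳ⁻ p c∈
    ... | inj₁ c∈p = inj₁ (i , j , k , a , b , c , i<j , j<k ,
                           At-∷ʳ-init p a∈ (≤-trans (<⇒≤ i<j) j≤) , At-∷ʳ-init p b∈ j≤ , c∈p ,
                           Rba , Scb)
      where
      j≤ : j ≤ length p
      j≤ = ≤-trans (<⇒≤ j<k) (At-length c∈p)
    ... | inj₂ (refl , refl) = inj₂ (b , (i , j , a , i<j ,
                           At-∷ʳ-init p a∈ (≤-trans (<⇒≤ i<j) (≤-pred j<k)) ,
                           At-∷ʳ-init p b∈ (≤-pred j<k) , Rba) , Scb)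
    join : Contains R S p ⊎ Completes p v → Contains R S (p ∷ʳ v)
    join (inj₁ c) = Contains-++ [ v ] c
    join (inj₂ (x , (i , j , a , i<j , a∈p , x∈p , Rxa) , Svx)) =
      i , j , suc (length p) , a , x , v , i<j , s≤s (At-length x∈p) ,
      At-++ [ v ] a∈p , At-++ [ v ] x∈p , At-middle p , Rxa , Svx

  -- A new middle value v needs some earlier entry a with R v a, and the maximum is the best candidate.
  Completes-∷ʳ : ∀ p → IsMax p M → Completes (p ∷ʳ v) w ⇔ (Completes p w ⊎ (R v M × S w v))
  Completes-∷ʳ {M} {v} p (≤M , k , M∈p) = mk⇔ split join
    where
    split : Completes (p ∷ʳ v) _ → Completes p _ ⊎ (R v M × S _ v)
    split (x , (i , j , a , i<j , a∈ , x∈ , Rxa) , Swx) with At-∷ʳ⁻ p x∈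
    ... | inj₁ x∈p = inj₁ (x , (i , j , a , i<j ,
                               At-∷ʳ-init p a∈ (≤-trans (<⇒≤ i<j) (At-length x∈p)) , x∈p , Rxa) , Swx)
    ... | inj₂ (refl , refl) = inj₂ (R-≤-trans Rxa (≤M i a (At-∷ʳ-init p a∈ (≤-pred i<j))) , Swx)
    join : Completes p _ ⊎ (R v M × S _ v) → Completes (p ∷ʳ v) _
    join (inj₁ c) = Completes-++ [ v ] c
    join (inj₂ (RvM , Swv)) =
      v , (k , suc (length p) , M , s≤s (At-length M∈p) , At-++ [ v ] M∈p , At-middle p , RvM) , Swv

  Threshold : List ℕ → ℕ → Set
  Threshold p T = ∀ w → Completes p w ⇔ w < T

-- (threshold, maximum) of the prefix read so far
State : Set
State = ℕ × ℕ

Allowed : State → ℕ → ℕ → Set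
Allowed (T , M) n v = T ≤ v × v ≤ n

module Automaton (R S : ℕ → ℕ → Set) (R-≤-trans : ∀ {v a M} → R v a → a ≤ M → R v M)
  (next : ℕ → ℕ → ℕ → ℕ)
  (next-spec : ∀ {T M v w} → T ≤ v → (w < T ⊎ (R v M × S w v)) ⇔ w < next T M v) where

  open Occurrences R S R-≤-trans

  step : State → ℕ → State
  step (T , M) v = next T M v , M ⊔ v

  Summarises : List ℕ → State → Set
  Summarises p (T , M) = Threshold p T × IsMax p M

  Summarises-∷ʳ : ∀ p → Summarises p (T , M) → T ≤ v → Summarises (p ∷ʳ v) (step (T , M) v)
  Summarises-∷ʳ p (thr , max) T≤v =
    (λ w → ⇔.trans (Completes-∷ʳ p max) (⇔.trans (thr w ⊎-⇔ ⇔.refl) (next-spec T≤v))) ,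
    IsMax-∷ʳ p max

  Avoids : List ℕ → Set
  Avoids e = Bounded e × ¬ Contains R S e

  Avoids-++⁻ : ∀ p q → Avoids (p ++ q) → Avoids p
  Avoids-++⁻ p q (bnd , ¬c) = (λ i w h → bnd i w (At-++ q h)) , (λ c → ¬c (Contains-++ q c))

  Avoids-∷ʳ : ∀ p → Summarises p (T , M) → Avoids p →
              Avoids (p ∷ʳ v) ⇔ Allowed (T , M) (length p) v
  Avoids-∷ʳ {T} {M} {v} p (thr , _) (bnd , ¬c) = mk⇔ allowed avoids
    where
    allowed : Avoids (p ∷ʳ v) → Allowed (T , M) (length p) v
    allowed (bnd′ , ¬c′) =
      ≮⇒≥ (λ v<T → ¬c′ (Contains-∷ʳ p .from (inj₂ (thr v .from v<T)))) ,
      ≤-pred (bnd′ _ v (At-middle p))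
    avoids : Allowed (T , M) (length p) v → Avoids (p ∷ʳ v)
    avoids (T≤v , v≤n) = bnd′ , ¬c′
      where
      bnd′ : Bounded (p ∷ʳ v)
      bnd′ i w h with At-∷ʳ⁻ p h
      ... | inj₁ h′            = bnd i w h′
      ... | inj₂ (refl , refl) = s≤s v≤n
      ¬c′ : ¬ Contains R S (p ∷ʳ v)
      ¬c′ c with Contains-∷ʳ p .to c
      ... | inj₁ c′   = ¬c c′
      ... | inj₂ comp = <⇒≱ (thr v .to comp) T≤v

  Good : State → ℕ → List ℕ → Set
  Good s n []      = ⊤
  Good s n (v ∷ r) = Allowed s n v × Good (step s v) (suc n) r

  Avoids-++⇔Good : ∀ p r → Summarises p (T , M) → Avoids p →
                   Avoids (p ++ r) ⇔ Good (T , M) (length p) r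
  Avoids-++⇔Good p []      _   av = mk⇔ (λ _ → tt) (λ _ → subst Avoids (sym (++-identityʳ p)) av)
  Avoids-++⇔Good {T} {M} p (v ∷ r) sum av = mk⇔ good avoids
    where
    prefix : Avoids (p ++ v ∷ r) → Avoids (p ∷ʳ v)
    prefix = Avoids-++⁻ (p ∷ʳ v) r ∘ subst Avoids (sym (∷ʳ-++ p v r))
    rest : Avoids (p ∷ʳ v) → T ≤ v →
           Avoids (p ++ v ∷ r) ⇔ Good (step (T , M) v) (suc (length p)) r
    rest av′ T≤v rewrite sym (∷ʳ-++ p v r) | sym (length-∷ʳ p v) =
      Avoids-++⇔Good (p ∷ʳ v) r (Summarises-∷ʳ p sum T≤v) av′
    good : Avoids (p ++ v ∷ r) → Good (T , M) (length p) (v ∷ r)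
    good avr = allowed , rest (prefix avr) (proj₁ allowed) .to avr
      where
      allowed : Allowed (T , M) (length p) v
      allowed = Avoids-∷ʳ p sum av .to (prefix avr)
    avoids : Good (T , M) (length p) (v ∷ r) → Avoids (p ++ v ∷ r)
    avoids (allowed , rest-good) =
      rest (Avoids-∷ʳ p sum av .from allowed) (proj₁ allowed) .from rest-good

  Summarises-[0] : Summarises [ 0 ] (0 , 0)
  Summarises-[0] =
    (λ _ → mk⇔ (λ (_ , mid , _) → contradiction mid no-middle) λ ()) ,
    (λ { _ _ here → z≤n }) , 1 , here
    where
    no-middle : ¬ Middle [ 0 ] x
    no-middle (_ , _ , _ , i<j , here , here , _) = <-irrefl refl i<j

  Avoids-[0] : Avoids [ 0 ]
  Avoids-[0] =
    (λ { _ _ here → s≤s z≤n }) ,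
    λ { (_ , _ , _ , _ , _ , _ , i<j , _ , here , here , _) → <-irrefl refl i<j }

  Avoids-∷⇔Good : Avoids (x ∷ r) ⇔ (x ≡ 0 × Good (0 , 0) 1 r)
  Avoids-∷⇔Good {x} {r} = mk⇔ good avoids
    where
    from-[0] : Avoids ([ 0 ] ++ r) ⇔ Good (0 , 0) 1 r
    from-[0] = Avoids-++⇔Good [ 0 ] r Summarises-[0] Avoids-[0]
    good : Avoids (x ∷ r) → x ≡ 0 × Good (0 , 0) 1 r
    good av with n<1⇒n≡0 (proj₁ av 1 x here)
    ... | refl = refl , from-[0] .to av
    avoids : x ≡ 0 × Good (0 , 0) 1 r → Avoids (x ∷ r)
    avoids (refl , good) = from-[0] .from good

next-gt-ge : ℕ → ℕ → ℕ → ℕ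
next-gt-ge T M v with v <? M
... | yes _ = suc v
... | no _  = T

next-ge-gt : ℕ → ℕ → ℕ → ℕ
next-ge-gt T M v with v ≤? M
... | yes _ = v
... | no _  = T

next-gt-ge-spec : T ≤ v → (w < T ⊎ (v < M × w ≤ v)) ⇔ w < next-gt-ge T M v
next-gt-ge-spec {T} {v} {w} {M} T≤v with v <? M
... | yes v<M = mk⇔ (λ { (inj₁ w<T)       → m<n⇒m<1+n (<-≤-trans w<T T≤v)
                        ; (inj₂ (_ , w≤v)) → s≤s w≤v })
                    (λ w<1+v → inj₂ (v<M , ≤-pred w<1+v))
... | no v≮M  = mk⇔ (λ { (inj₁ w<T) → w<T ; (inj₂ (v<M , _)) → contradiction v<M v≮M }) inj₁

next-ge-gt-spec : T ≤ v → (w < T ⊎ (v ≤ M × w < v)) ⇔ w < next-ge-gt T M v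
next-ge-gt-spec {T} {v} {w} {M} T≤v with v ≤? M
... | yes v≤M = mk⇔ (λ { (inj₁ w<T)       → <-≤-trans w<T T≤v
                        ; (inj₂ (_ , w<v)) → w<v })
                    (λ w<v → inj₂ (v≤M , w<v))
... | no v≰M  = mk⇔ (λ { (inj₁ w<T) → w<T ; (inj₂ (v≤M , _)) → contradiction v≤M v≰M }) inj₁

module GtGe = Automaton _<_ _≤_ <-≤-trans next-gt-ge next-gt-ge-spec
module GeGt = Automaton _≤_ _<_ ≤-trans next-ge-gt next-ge-gt-spec

next-gt-ge-< : v < M → next-gt-ge T M v ≡ suc v
next-gt-ge-< {v} {M} v<M with v <? M
... | yes _   = refl
... | no v≮M  = contradiction v<M v≮M

next-gt-ge-≥ : M ≤ v → next-gt-ge T M v ≡ T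
next-gt-ge-≥ {M} {v} M≤v with v <? M
... | yes v<M = contradiction M≤v (<⇒≱ v<M)
... | no _    = refl

next-ge-gt-≤ : v ≤ M → next-ge-gt T M v ≡ v
next-ge-gt-≤ {v} {M} v≤M with v ≤? M
... | yes _   = refl
... | no v≰M  = contradiction v≤M v≰M

next-ge-gt-> : M < v → next-ge-gt T M v ≡ T
next-ge-gt-> {M} {v} M<v with v ≤? M
... | yes v≤M = contradiction v≤M (<⇒≱ M<v)
... | no _    = refl

-- The cyclic shift of [T , M]; unrotate is its inverse. Values below T are never used.
rotate : State → ℕ → ℕ
rotate (T , M) v with <-cmp v M
... | tri< _ _ _ = suc v
... | tri≈ _ _ _ = T
... | tri> _ _ _ = v

unrotate : State → ℕ → ℕ
unrotate (T , M) w with w ≟ T | w ≤? M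
... | yes _ | _     = M
... | no _  | yes _ = pred w
... | no _  | no _  = w

rotate-< : v < M → rotate (T , M) v ≡ suc v
rotate-< {v} {M} v<M with <-cmp v M
... | tri< _ _ _   = refl
... | tri≈ v≮M _ _ = contradiction v<M v≮M
... | tri> v≮M _ _ = contradiction v<M v≮M

rotate-top : rotate (T , M) M ≡ T
rotate-top {M = M} with <-cmp M M
... | tri< _ M≢M _ = contradiction refl M≢M
... | tri≈ _ _ _   = refl
... | tri> _ M≢M _ = contradiction refl M≢M

rotate-> : M < v → rotate (T , M) v ≡ v
rotate-> {M} {v} M<v with <-cmp v M
... | tri< _ _ v≯M = contradiction M<v v≯M
... | tri≈ _ _ v≯M = contradiction M<v v≯M
... | tri> _ _ _   = refl

unrotate-bottom : unrotate (T , M) T ≡ M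
unrotate-bottom {T} {M} with T ≟ T | T ≤? M
... | yes _   | _ = refl
... | no T≢T  | _ = contradiction refl T≢T

unrotate-inner : T < w → w ≤ M → unrotate (T , M) w ≡ pred w
unrotate-inner {T} {w} {M} T<w w≤M with w ≟ T | w ≤? M
... | yes refl | _      = contradiction T<w (<-irrefl refl)
... | no _     | yes _  = refl
... | no _     | no w≰M = contradiction w≤M w≰M

unrotate-> : T ≤ M → M < w → unrotate (T , M) w ≡ w
unrotate-> {T} {M} {w} T≤M M<w with w ≟ T | w ≤? M
... | yes refl | _      = contradiction T≤M (<⇒≱ M<w)
... | no _     | yes w≤M = contradiction w≤M (<⇒≱ M<w)
... | no _     | no _   = refl

Valid : State → ℕ → Set
Valid (T , M) n = T ≤ M × M ≤ n

GtGe-step-Valid : Valid (T , M) n → Allowed (T , M) n v → Valid (GtGe.step (T , M) v) (suc n)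
GtGe-step-Valid {T} {M} {n} {v} (T≤M , M≤n) (_ , v≤n) = next≤M⊔v , m≤n⇒m≤1+n (⊔-lub M≤n v≤n)
  where
  next≤M⊔v : next-gt-ge T M v ≤ M ⊔ v
  next≤M⊔v with v <? M
  ... | yes v<M = ≤-trans v<M (m≤m⊔n M v)
  ... | no _    = ≤-trans T≤M (m≤m⊔n M v)

GeGt-step-Valid : Valid (T , M) n → Allowed (T , M) n v → Valid (GeGt.step (T , M) v) (suc n)
GeGt-step-Valid {T} {M} {n} {v} (T≤M , M≤n) (_ , v≤n) = next≤M⊔v , m≤n⇒m≤1+n (⊔-lub M≤n v≤n)
  where
  next≤M⊔v : next-ge-gt T M v ≤ M ⊔ v
  next≤M⊔v with v ≤? M
  ... | yes _ = m≤n⊔m M v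
  ... | no _  = ≤-trans T≤M (m≤m⊔n M v)

rotate-Allowed : Valid (T , M) n → Allowed (T , M) n v → Allowed (T , M) n (rotate (T , M) v)
rotate-Allowed {T} {M} {n} {v} (T≤M , M≤n) (T≤v , v≤n) with <-cmp v M
... | tri< v<M _ _ = m≤n⇒m≤1+n T≤v , ≤-trans v<M M≤n
... | tri≈ _ _ _   = ≤-refl , ≤-trans T≤M M≤n
... | tri> _ _ _   = T≤v , v≤n

unrotate-Allowed : Valid (T , M) n → Allowed (T , M) n w → Allowed (T , M) n (unrotate (T , M) w)
unrotate-Allowed {T} {M} {n} {w} (T≤M , M≤n) (T≤w , w≤n) with w ≟ T | w ≤? M
... | yes _  | _     = T≤M , M≤n
... | no w≢T | yes _ = <⇒≤pred (≤∧≢⇒< T≤w (w≢T ∘ sym)) , ≤-trans pred[n]≤n w≤n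
... | no _   | no _  = T≤w , w≤n

rotate-step : T ≤ M → GeGt.step (T , M) (rotate (T , M) v) ≡ GtGe.step (T , M) v
rotate-step {T} {M} {v} T≤M with <-cmp v M
... | tri< v<M _ _  = cong₂ _,_ (trans (next-ge-gt-≤ v<M) (sym (next-gt-ge-< v<M)))
                                (trans (m≥n⇒m⊔n≡m v<M) (sym (m≥n⇒m⊔n≡m (<⇒≤ v<M))))
... | tri≈ _ refl _ = cong₂ _,_ (trans (next-ge-gt-≤ T≤M) (sym (next-gt-ge-≥ ≤-refl)))
                                (trans (m≥n⇒m⊔n≡m T≤M) (sym (⊔-idem M)))
... | tri> _ _ M<v  = cong₂ _,_ (trans (next-ge-gt-> M<v) (sym (next-gt-ge-≥ (<⇒≤ M<v)))) refl

unrotate-rotate : T ≤ M → T ≤ v → unrotate (T , M) (rotate (T , M) v) ≡ v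
unrotate-rotate {T} {M} {v} T≤M T≤v with <-cmp v M
... | tri< v<M _ _  = unrotate-inner (s≤s T≤v) v<M
... | tri≈ _ refl _ = unrotate-bottom {T}
... | tri> _ _ M<v  = unrotate-> T≤M M<v

rotate-unrotate : T ≤ M → T ≤ w → rotate (T , M) (unrotate (T , M) w) ≡ w
rotate-unrotate {T} {M} {w} T≤M T≤w with w ≟ T | w ≤? M
... | yes refl | _       = rotate-top {T} {M}
... | no w≢T   | yes w≤M = trans (rotate-< (subst (_≤ M) (sym suc-pred-w) w≤M)) suc-pred-w
  where
  suc-pred-w : suc (pred w) ≡ w
  suc-pred-w = suc-pred w {{>-nonZero (≤-trans (s≤s z≤n) (≤∧≢⇒< T≤w (w≢T ∘ sym)))}}
... | no _     | no w≰M  = rotate-> (≰⇒> w≰M)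

unrotate-step : T ≤ M → T ≤ w → GtGe.step (T , M) (unrotate (T , M) w) ≡ GeGt.step (T , M) w
unrotate-step T≤M T≤w =
  trans (sym (rotate-step T≤M)) (cong (GeGt.step _) (rotate-unrotate T≤M T≤w))

rotateWord : State → List ℕ → List ℕ
rotateWord s []      = []
rotateWord s (v ∷ r) = rotate s v ∷ rotateWord (GtGe.step s v) r

unrotateWord : State → List ℕ → List ℕ
unrotateWord s []      = []
unrotateWord s (w ∷ r) = unrotate s w ∷ unrotateWord (GeGt.step s w) r

length-rotateWord : ∀ s r → length (rotateWord s r) ≡ length r
length-rotateWord s []      = refl
length-rotateWord s (v ∷ r) = cong suc (length-rotateWord _ r)

length-unrotateWord : ∀ s r → length (unrotateWord s r) ≡ length r
length-unrotateWord s []      = refl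
length-unrotateWord s (w ∷ r) = cong suc (length-unrotateWord _ r)

rotateWord-Good : Valid (T , M) n → GtGe.Good (T , M) n r →
                  GeGt.Good (T , M) n (rotateWord (T , M) r)
rotateWord-Good {r = []}    _ _ = tt
rotateWord-Good {T} {M} {n} {v ∷ r} valid@(T≤M , _) (allowed , good) =
  rotate-Allowed valid allowed ,
  subst (λ s → GeGt.Good s (suc n) (rotateWord (GtGe.step (T , M) v) r)) (sym (rotate-step T≤M))
    (rotateWord-Good (GtGe-step-Valid valid allowed) good)

unrotateWord-Good : Valid (T , M) n → GeGt.Good (T , M) n r →
                    GtGe.Good (T , M) n (unrotateWord (T , M) r)
unrotateWord-Good {r = []}    _ _ = tt
unrotateWord-Good {T} {M} {n} {w ∷ r} valid@(T≤M , _) (allowed@(T≤w , _) , good) =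
  unrotate-Allowed valid allowed ,
  subst (λ s → GtGe.Good s (suc n) (unrotateWord (GeGt.step (T , M) w) r))
    (sym (unrotate-step T≤M T≤w))
    (unrotateWord-Good (GeGt-step-Valid valid allowed) good)

unrotate-rotateWord : Valid (T , M) n → GtGe.Good (T , M) n r →
                      unrotateWord (T , M) (rotateWord (T , M) r) ≡ r
unrotate-rotateWord {r = []}    _ _ = refl
unrotate-rotateWord {T} {M} {n} {v ∷ r} valid@(T≤M , _) (allowed@(T≤v , _) , good) =
  cong₂ _∷_ (unrotate-rotate T≤M T≤v)
    (trans (cong (λ s → unrotateWord s (rotateWord (GtGe.step (T , M) v) r)) (rotate-step T≤M))
      (unrotate-rotateWord (GtGe-step-Valid valid allowed) good))

rotate-unrotateWord : Valid (T , M) n → GeGt.Good (T , M) n r →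
                      rotateWord (T , M) (unrotateWord (T , M) r) ≡ r
rotate-unrotateWord {r = []}    _ _ = refl
rotate-unrotateWord {T} {M} {n} {w ∷ r} valid@(T≤M , _) (allowed@(T≤w , _) , good) =
  cong₂ _∷_ (rotate-unrotate T≤M T≤w)
    (trans (cong (λ s → rotateWord s (unrotateWord (GeGt.step (T , M) w) r)) (unrotate-step T≤M T≤w))
      (rotate-unrotateWord (GeGt-step-Valid valid allowed) good))

rotateSeq : List ℕ → List ℕ
rotateSeq []      = []
rotateSeq (x ∷ r) = x ∷ rotateWord (0 , 0) r

unrotateSeq : List ℕ → List ℕ
unrotateSeq []      = []
unrotateSeq (x ∷ r) = x ∷ unrotateWord (0 , 0) r

rotateSeq-avoids : IsInvSeq n e × ¬ Contains-gt-ge e →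
                   IsInvSeq n (rotateSeq e) × ¬ Contains-ge-gt (rotateSeq e)
rotateSeq-avoids {e = []}    ((len , _) , _) = (len , λ _ _ ()) , Contains-[]
rotateSeq-avoids {e = x ∷ r} ((len , bnd) , ¬c) with GtGe.Avoids-∷⇔Good .to (bnd , ¬c)
... | refl , good = (trans (cong suc (length-rotateWord _ r)) len , proj₁ avoids) , proj₂ avoids
  where
  avoids : GeGt.Avoids (0 ∷ rotateWord (0 , 0) r)
  avoids = GeGt.Avoids-∷⇔Good .from (refl , rotateWord-Good (z≤n , z≤n) good)

unrotateSeq-avoids : IsInvSeq n e × ¬ Contains-ge-gt e →
                     IsInvSeq n (unrotateSeq e) × ¬ Contains-gt-ge (unrotateSeq e)
unrotateSeq-avoids {e = []}    ((len , _) , _) = (len , λ _ _ ()) , Contains-[]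
unrotateSeq-avoids {e = x ∷ r} ((len , bnd) , ¬c) with GeGt.Avoids-∷⇔Good .to (bnd , ¬c)
... | refl , good = (trans (cong suc (length-unrotateWord _ r)) len , proj₁ avoids) , proj₂ avoids
  where
  avoids : GtGe.Avoids (0 ∷ unrotateWord (0 , 0) r)
  avoids = GtGe.Avoids-∷⇔Good .from (refl , unrotateWord-Good (z≤n , z≤n) good)

unrotateSeq-rotateSeq : IsInvSeq n e × ¬ Contains-gt-ge e → unrotateSeq (rotateSeq e) ≡ e
unrotateSeq-rotateSeq {e = []}    _ = refl
unrotateSeq-rotateSeq {e = x ∷ r} ((_ , bnd) , ¬c) with GtGe.Avoids-∷⇔Good .to (bnd , ¬c)
... | refl , good = cong (0 ∷_) (unrotate-rotateWord (z≤n , z≤n) good)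

rotateSeq-unrotateSeq : IsInvSeq n e × ¬ Contains-ge-gt e → rotateSeq (unrotateSeq e) ≡ e
rotateSeq-unrotateSeq {e = []}    _ = refl
rotateSeq-unrotateSeq {e = x ∷ r} ((_ , bnd) , ¬c) with GeGt.Avoids-∷⇔Good .to (bnd , ¬c)
... | refl , good = cong (0 ∷_) (rotate-unrotateWord (z≤n , z≤n) good)

mainTheorem16 : (n : ℕ) → n ≥ 1 → (p q : ℕ)
    → HasCard (λ e → IsInvSeq n e × ¬ Contains-gt-ge e) p
    → HasCard (λ e → IsInvSeq n e × ¬ Contains-ge-gt e) q
    → p ≡ q
mainTheorem16 n _ p q =
  HasCard-bijection rotateSeq unrotateSeq
    rotateSeq-avoids unrotateSeq-avoids unrotateSeq-rotateSeq rotateSeq-unrotateSeq
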